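{- Let $k\ge 0$ be an integer and $n=48k+38$. Define $c_2(r)\in\mathbb{Z}_n$ for $0\le r\le n-1$ as follows (all arithmetic modulo $n$): for $0\le i\le 12k+9$, $c_2(2i)=30k+23+i(12k+10)$; for $0\le i\le 12k+8$, $c_2(2i+1)=12k+9+i(12k+10)$ (this defines $c_2(r)$ for $0\le r\le 24k+18$); and for $0\le r\le 24k+18$, $c_2(n-1-r)=n-1-c_2(r)$. Let ${\cal L}_2=[l_2(r,j)]$ be the $n\times n$ array with $l_2(r,j)\equiv c_2(r)+j \pmod n$ for $0\le r,j\le n-1$. Then ${\cal L}_2$ is a Latin square of order $n$.
   Context: A Latin square of order $n$ is an $n\times n$ array in which each row and each column contains each of the symbols $0,1,\dots,n-1$ exactly once. -}

module Defs where

open import Data.Nat using (ℕ; zero; suc; _+_; _*_; _∸_; _≤ᵇ_; _<_)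
open import Data.Nat.DivMod using (_%_; _/_; m%n<n)
open import Data.Bool using (if_then_else_)
open import Data.Fin using (Fin; toℕ; fromℕ<)
open import Data.Product using (Σ; _×_; _,_)
open import Relation.Binary.PropositionalEquality using (_≡_)

ExactlyOnce : {n : ℕ} → (Fin n → Fin n) → Fin n → Set
ExactlyOnce {n} f s = Σ (Fin n) λ j → (f j ≡ s) × (∀ j' → f j' ≡ s → j' ≡ j)

IsLatinSquare : (n : ℕ) → (Fin n → Fin n → Fin n) → Set
IsLatinSquare n L =
  (∀ r s → ExactlyOnce (λ j → L r j) s) × (∀ j s → ExactlyOnce (λ r → L r j) s)

ord : ℕ → ℕ
ord k = suc (48 * k + 37)

c₂-half : ℕ → ℕ → ℕ
c₂-half k r =
  if r % 2 ≤ᵇ 0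
  then (30 * k + 23 + (r / 2) * (12 * k + 10)) % ord k
  else (12 * k + 9 + (r / 2) * (12 * k + 10)) % ord k

-- full c₂ : for r ≤ 24k+18 use the half definition; otherwise
-- r = n-1-r' with r' = n-1-r ≤ 24k+18 and c₂(r) = n-1-c₂(r').
c₂ : ℕ → ℕ → ℕ
c₂ k r =
  if r ≤ᵇ 24 * k + 18
  then c₂-half k r
  else (ord k ∸ 1) ∸ c₂-half k ((ord k ∸ 1) ∸ r)

L₂ : (k : ℕ) → Fin (ord k) → Fin (ord k) → Fin (ord k)
L₂ k r j = fromℕ< (m%n<n (c₂ k (toℕ r) + toℕ j) (ord k))

-- Since l₂(r, j) = c₂(r) + j, every row is a cyclic shift of ℤ_n, and the square is
-- Latin as soon as c₂ is a permutation of ℤ_n; on a finite set it suffices that c₂ is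
-- onto. Write D = 12k + 10, so that 4D = n + 2: moving eight places down the first half
-- increases c₂ by 2 modulo n. Hence each residue class of r modulo 8 in the first half
-- is sent onto a run of consecutive odd numbers, and the eight runs tile the odd
-- residues. The reflection c₂(n-1-r) = n-1-c₂(r) then sends the second half onto the
-- even residues.
module Submission where

open import Defs
open import Data.Bool using (true; false; if_then_else_)
open import Data.Unit using (tt)
open import Data.Fin using (Fin; toℕ; fromℕ<; punchOut)
open import Data.Fin.Properties
  using (any?; punchOut-injective; injective⇒≤; toℕ-injective; toℕ-fromℕ<; toℕ<n)
  renaming (_≟_ to _≟ᶠ_)
open import Data.List using ([]; _∷_)
open import Data.Nat
  using (ℕ; zero; suc; _+_; _*_; _∸_; _≤_; _<_; _≤ᵇ_; _<?_; z≤n; s≤s; NonZero)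
open import Data.Nat.DivMod
open import Data.Nat.Divisibility using (divides)
open import Data.Nat.Properties
open import Data.Nat.Tactic.RingSolver using (solve; solve-∀)
open import Data.Product using (∃; _×_; _,_; proj₁; proj₂)
open import Function.Base using (_∘_)
open import Function.Definitions using (Injective; StrictlySurjective)
open import Relation.Binary.PropositionalEquality
open import Relation.Nullary using (yes; no; contradiction)

injective⇒strictlySurjective : ∀ {n} {f : Fin n → Fin n} →
                               Injective _≡_ _≡_ f → StrictlySurjective _≡_ f
injective⇒strictlySurjective {suc n} {f} f-inj y with any? (λ x → f x ≟ᶠ y)
... | yes hit = hit
... | no miss = contradiction (injective⇒≤ punchOut-inj) 1+n≰n
  where
  y≢f : ∀ x → y ≢ f x
  y≢f x y≡fx = miss (x , sym y≡fx)

  punchOut-inj : Injective _≡_ _≡_ (λ x → punchOut (y≢f x))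
  punchOut-inj eq = f-inj (punchOut-injective (y≢f _) (y≢f _) eq)

strictlySurjective⇒injective : ∀ {n} {f : Fin n → Fin n} →
                               StrictlySurjective _≡_ f → Injective _≡_ _≡_ f
strictlySurjective⇒injective {n} {f} surj {i} {j} fi≡fj = begin
  i        ≡⟨ g∘f i ⟨
  g (f i)  ≡⟨ cong g fi≡fj ⟩
  g (f j)  ≡⟨ g∘f j ⟩
  j        ∎
  where
  open ≡-Reasoning
  g : Fin n → Fin n
  g = proj₁ ∘ surj

  f∘g : ∀ y → f (g y) ≡ y
  f∘g = proj₂ ∘ surj

  g-inj : Injective _≡_ _≡_ g
  g-inj {y} {y′} eq = trans (sym (f∘g y)) (trans (cong f eq) (f∘g y′))

  g∘f : ∀ x → g (f x) ≡ x
  g∘f x with a , ga≡x ← injective⇒strictlySurjective g-inj x =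
    trans (cong (g ∘ f) (sym ga≡x)) (trans (cong g (f∘g a)) ga≡x)

strictlySurjective⇒exactlyOnce : ∀ {n} {f : Fin n → Fin n} →
                                 StrictlySurjective _≡_ f → ∀ s → ExactlyOnce f s
strictlySurjective⇒exactlyOnce surj s with x , fx≡s ← surj s =
  x , fx≡s , λ x′ fx′≡s → strictlySurjective⇒injective surj (trans fx′≡s (sym fx≡s))

+-%-onto : ∀ n .{{_ : NonZero n}} a {s} → s < n → ∃ λ x → x < n × (x + a) % n ≡ s
+-%-onto n@(suc m) a {s} s<n = y % n , m%n<n y n , (begin
  (y % n + a) % n            ≡⟨ %-distribˡ-+ (y % n) a n ⟩
  (y % n % n + a % n) % n    ≡⟨ cong (λ v → (v + a % n) % n) (m%n%n≡m%n y n) ⟩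
  (y % n + a % n) % n        ≡⟨ %-distribˡ-+ y a n ⟨
  (y + a) % n                ≡⟨ cong (_% n) y+a≡s+a*n ⟩
  (s + a * n) % n            ≡⟨ [m+kn]%n≡m%n s a n ⟩
  s % n                      ≡⟨ m<n⇒m%n≡m s<n ⟩
  s                          ∎)
  where
  open ≡-Reasoning
  y : ℕ
  y = s + m * a

  y+a≡s+a*n : s + m * a + a ≡ s + a * suc m
  y+a≡s+a*n = solve (s ∷ m ∷ a ∷ [])

shiftSquare : (n : ℕ) .{{_ : NonZero n}} → (Fin n → ℕ) → Fin n → Fin n → Fin n
shiftSquare n c r j = fromℕ< (m%n<n (c r + toℕ j) n)

toℕ-shiftSquare : ∀ n .{{_ : NonZero n}} c r j →
                  toℕ (shiftSquare n c r j) ≡ (c r + toℕ j) % n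
toℕ-shiftSquare n c r j = toℕ-fromℕ< _

shiftSquare-isLatinSquare : ∀ n .{{_ : NonZero n}} (c : Fin n → ℕ) →
                            (∀ {x} → x < n → ∃ λ r → c r ≡ x) →
                            IsLatinSquare n (shiftSquare n c)
shiftSquare-isLatinSquare n c c-onto = rows , columns
  where
  rows : ∀ r s → ExactlyOnce (shiftSquare n c r) s
  rows r = strictlySurjective⇒exactlyOnce hit
    where
    hit : StrictlySurjective _≡_ (shiftSquare n c r)
    hit s with x , x<n , x+cr≡s ← +-%-onto n (c r) (toℕ<n s) =
      fromℕ< x<n , toℕ-injective (begin
        toℕ (shiftSquare n c r (fromℕ< x<n))
          ≡⟨ toℕ-shiftSquare n c r (fromℕ< x<n) ⟩
        (c r + toℕ (fromℕ< x<n)) % n  ≡⟨ cong (λ v → (c r + v) % n) (toℕ-fromℕ< x<n) ⟩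
        (c r + x) % n                 ≡⟨ cong (_% n) (+-comm (c r) x) ⟩
        (x + c r) % n                 ≡⟨ x+cr≡s ⟩
        toℕ s                         ∎)
      where open ≡-Reasoning

  columns : ∀ j s → ExactlyOnce (λ r → shiftSquare n c r j) s
  columns j = strictlySurjective⇒exactlyOnce hit
    where
    hit : StrictlySurjective _≡_ (λ r → shiftSquare n c r j)
    hit s with x , x<n , x+j≡s ← +-%-onto n (toℕ j) (toℕ<n s)
          with r , cr≡x ← c-onto x<n =
      r , toℕ-injective (begin
        toℕ (shiftSquare n c r j)  ≡⟨ toℕ-shiftSquare n c r j ⟩
        (c r + toℕ j) % n          ≡⟨ cong (λ v → (v + toℕ j) % n) cr≡x ⟩
        (x + toℕ j) % n            ≡⟨ x+j≡s ⟩
        toℕ s                      ∎)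
      where open ≡-Reasoning

c₂-lift : ℕ → ℕ → ℕ
c₂-lift k r = (if r % 2 ≤ᵇ 0 then 30 * k + 23 else 12 * k + 9) + (r / 2) * (12 * k + 10)

c₂-lift-even : ∀ k i → c₂-lift k (i * 2) ≡ 30 * k + 23 + i * (12 * k + 10)
c₂-lift-even k i rewrite m*n%n≡0 i 2 ⦃ _ ⦄ | m*n/n≡m i 2 ⦃ _ ⦄ = refl

c₂-lift-odd : ∀ k i → c₂-lift k (1 + i * 2) ≡ 12 * k + 9 + i * (12 * k + 10)
c₂-lift-odd k i
  rewrite [m+kn]%n≡m%n 1 i 2 ⦃ _ ⦄
        | +-distrib-/-∣ʳ 1 {i * 2} {2} ⦃ _ ⦄ (divides i refl)
        | m*n/n≡m i 2 ⦃ _ ⦄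
        = refl

c₂-half≡c₂-lift% : ∀ k r → c₂-half k r ≡ c₂-lift k r % ord k
c₂-half≡c₂-lift% k r with r % 2 ≤ᵇ 0
... | true  = refl
... | false = refl

c₂-lift-8+ : ∀ k r → c₂-lift k (8 + r) ≡ c₂-lift k r + (2 + ord k)
c₂-lift-8+ k r = trans
  (cong (λ i → base + i * (12 * k + 10)) (+-distrib-/-∣ˡ {8} r {2} (divides 4 refl)))
  (four-steps k base (r / 2))
  where
  base : ℕ
  base = if r % 2 ≤ᵇ 0 then 30 * k + 23 else 12 * k + 9

  four-steps : ∀ k b i → b + (4 + i) * (12 * k + 10) ≡
                         b + i * (12 * k + 10) + (2 + suc (48 * k + 37))
  four-steps = solve-∀

c₂-lift-*8+ : ∀ k q ρ → c₂-lift k (q * 8 + ρ) ≡ c₂-lift k ρ + q * (2 + ord k)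
c₂-lift-*8+ k zero    ρ = sym (+-identityʳ _)
c₂-lift-*8+ k (suc q) ρ = begin
  c₂-lift k (8 + (q * 8 + ρ))
    ≡⟨ c₂-lift-8+ k (q * 8 + ρ) ⟩
  c₂-lift k (q * 8 + ρ) + (2 + ord k)
    ≡⟨ cong (_+ (2 + ord k)) (c₂-lift-*8+ k q ρ) ⟩
  c₂-lift k ρ + q * (2 + ord k) + (2 + ord k)
    ≡⟨ +-assoc (c₂-lift k ρ) _ _ ⟩
  c₂-lift k ρ + (q * (2 + ord k) + (2 + ord k))
    ≡⟨ cong (c₂-lift k ρ +_) (+-comm _ (2 + ord k)) ⟩
  c₂-lift k ρ + suc q * (2 + ord k)
    ∎
  where open ≡-Reasoning

1+2*half≡ord∸1 : ∀ k → 1 + 2 * (24 * k + 18) ≡ 48 * k + 37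
1+2*half≡ord∸1 = solve-∀

1+2t<ord : ∀ k {t} → t ≤ 24 * k + 18 → 1 + 2 * t < ord k
1+2t<ord k {t} t≤half =
  s≤s (subst (1 + 2 * t ≤_) (1+2*half≡ord∸1 k) (+-monoʳ-≤ 1 (*-monoʳ-≤ 2 t≤half)))

2t<ord⇒t≤half : ∀ k {t} → 2 * t < ord k → t ≤ 24 * k + 18
2t<ord⇒t≤half k {t} 2t<n =
  <⇒≤pred (*-cancelˡ-< 2 t (suc (24 * k + 18)) (subst (2 * t <_) (ord≡2*[1+half] k) 2t<n))
  where
  ord≡2*[1+half] : ∀ k → suc (48 * k + 37) ≡ 2 * suc (24 * k + 18)
  ord≡2*[1+half] = solve-∀

HalfPreimage : ℕ → ℕ → Set
HalfPreimage k y = ∃ λ r → r ≤ 24 * k + 18 × c₂-half k r ≡ y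

-- The indices r = q * 8 + residue of the first half are sent by c₂ onto the odd values
-- 1 + 2 * t with start ≤ t < stop (wraps counts the multiples of n dropped at q = 0);
-- fits says that the last of these indices is still ≤ 24k + 18.
record ResidueClass (k start : ℕ) : Set where
  field
    residue stop wraps slack : ℕ
    lift-residue : c₂-lift k residue ≡ 1 + 2 * start + wraps * ord k
    fits : 8 * stop + residue + slack ≡ 24 * k + 18 + 8 * suc start

residueClass-hits : ∀ {k start} (c : ResidueClass k start) {t} →
                    start ≤ t → t < ResidueClass.stop c → t ≤ 24 * k + 18 →
                    HalfPreimage k (1 + 2 * t)
residueClass-hits {k} {start} c {t} start≤t t<stop t≤half =
  q * 8 + residue , index-bound , value
  where
  open ResidueClass c
  q : ℕ
  q = t ∸ start

  start+q≡t : start + q ≡ t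
  start+q≡t = m+[n∸m]≡n start≤t

  index-bound : q * 8 + residue ≤ 24 * k + 18
  index-bound = +-cancelʳ-≤ (8 * suc start) _ _ (begin
    q * 8 + residue + 8 * suc start  ≡⟨ shuffle q residue start ⟩
    8 * suc (start + q) + residue    ≡⟨ cong (λ v → 8 * suc v + residue) start+q≡t ⟩
    8 * suc t + residue              ≤⟨ +-monoˡ-≤ residue (*-monoʳ-≤ 8 t<stop) ⟩
    8 * stop + residue               ≤⟨ m≤m+n _ slack ⟩
    8 * stop + residue + slack       ≡⟨ fits ⟩
    24 * k + 18 + 8 * suc start      ∎)
    where
    open ≤-Reasoning using (begin_; step-≡-⟩; step-≤; _∎)
    shuffle : ∀ q ρ s → q * 8 + ρ + 8 * suc s ≡ 8 * suc (s + q) + ρ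
    shuffle = solve-∀

  regroup : ∀ s e q n → 1 + 2 * s + e * n + q * (2 + n) ≡ 1 + 2 * (s + q) + (e + q) * n
  regroup = solve-∀

  value : c₂-half k (q * 8 + residue) ≡ 1 + 2 * t
  value = begin
    c₂-half k (q * 8 + residue)
      ≡⟨ c₂-half≡c₂-lift% k (q * 8 + residue) ⟩
    c₂-lift k (q * 8 + residue) % ord k
      ≡⟨ cong (_% ord k) (c₂-lift-*8+ k q residue) ⟩
    (c₂-lift k residue + q * (2 + ord k)) % ord k
      ≡⟨ cong (λ v → (v + q * (2 + ord k)) % ord k) lift-residue ⟩
    (1 + 2 * start + wraps * ord k + q * (2 + ord k)) % ord k
      ≡⟨ cong (_% ord k) (regroup start wraps q (ord k)) ⟩
    (1 + 2 * (start + q) + (wraps + q) * ord k) % ord k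
      ≡⟨ [m+kn]%n≡m%n (1 + 2 * (start + q)) (wraps + q) (ord k) ⟩
    (1 + 2 * (start + q)) % ord k
      ≡⟨ cong (λ v → (1 + 2 * v) % ord k) start+q≡t ⟩
    (1 + 2 * t) % ord k
      ≡⟨ m<n⇒m%n≡m (1+2t<ord k t≤half) ⟩
    1 + 2 * t
      ∎
    where open ≡-Reasoning

evenClass : ∀ {k} start i stop wraps slack →
            30 * k + 23 + i * (12 * k + 10) ≡ 1 + 2 * start + wraps * suc (48 * k + 37) →
            8 * stop + i * 2 + slack ≡ 24 * k + 18 + 8 * suc start →
            ResidueClass k start
evenClass {k} start i stop wraps slack lift fits = record
  { residue = i * 2 ; stop = stop ; wraps = wraps ; slack = slack
  ; lift-residue = trans (c₂-lift-even k i) lift ; fits = fits }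

oddClass : ∀ {k} start i stop wraps slack →
           12 * k + 9 + i * (12 * k + 10) ≡ 1 + 2 * start + wraps * suc (48 * k + 37) →
           8 * stop + (1 + i * 2) + slack ≡ 24 * k + 18 + 8 * suc start →
           ResidueClass k start
oddClass {k} start i stop wraps slack lift fits = record
  { residue = 1 + i * 2 ; stop = stop ; wraps = wraps ; slack = slack
  ; lift-residue = trans (c₂-lift-odd k i) lift ; fits = fits }

data Tiling (k : ℕ) : ℕ → Set where
  []  : Tiling k (suc (24 * k + 18))
  _∷_ : ∀ {start} (c : ResidueClass k start) → Tiling k (ResidueClass.stop c) → Tiling k start

tiling-hits : ∀ {k start} → Tiling k start → ∀ {t} → start ≤ t → t ≤ 24 * k + 18 →
              HalfPreimage k (1 + 2 * t)
tiling-hits []       start≤t t≤half = contradiction (≤-trans start≤t t≤half) 1+n≰n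
tiling-hits (c ∷ cs) {t} start≤t t≤half with t <? ResidueClass.stop c
... | yes t<stop = residueClass-hits c start≤t t<stop t≤half
... | no  t≮stop = tiling-hits cs (≮⇒≥ t≮stop) t≤half

c₂-tiling : ∀ k → Tiling k 0
c₂-tiling k =
    oddClass  0            3 (3 * k + 2)          1 3 (solve (k ∷ [])) (solve (k ∷ []))
  ∷ evenClass (3 * k + 2)  2 (6 * k + 4)          1 6 (solve (k ∷ [])) (solve (k ∷ []))
  ∷ oddClass  (6 * k + 4)  0 (9 * k + 7)          0 1 (solve (k ∷ [])) (solve (k ∷ []))
  ∷ evenClass (9 * k + 7)  3 (12 * k + 9)         1 4 (solve (k ∷ [])) (solve (k ∷ []))
  ∷ oddClass  (12 * k + 9) 1 (15 * k + 11)        0 7 (solve (k ∷ [])) (solve (k ∷ []))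
  ∷ evenClass (15 * k + 11) 0 (18 * k + 14)       0 2 (solve (k ∷ [])) (solve (k ∷ []))
  ∷ oddClass  (18 * k + 14) 2 (21 * k + 16)       0 5 (solve (k ∷ [])) (solve (k ∷ []))
  ∷ evenClass (21 * k + 16) 1 (suc (24 * k + 18)) 0 0 (solve (k ∷ [])) (solve (k ∷ []))
  ∷ []

-- Opaque so that with-abstraction over it never unfolds the solver proofs in c₂-tiling.
opaque
  c₂-half-onto-odd : ∀ k {t} → t ≤ 24 * k + 18 → HalfPreimage k (1 + 2 * t)
  c₂-half-onto-odd k = tiling-hits (c₂-tiling k) z≤n

c₂-first-half : ∀ k {r} → r ≤ 24 * k + 18 → c₂ k r ≡ c₂-half k r
c₂-first-half k {r} r≤half with r ≤ᵇ 24 * k + 18 | ≤⇒≤ᵇ r≤half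
... | true | _ = refl

c₂-second-half : ∀ k {r} → 24 * k + 18 < r →
                 c₂ k r ≡ 48 * k + 37 ∸ c₂-half k (48 * k + 37 ∸ r)
c₂-second-half k {r} half<r with r ≤ᵇ 24 * k + 18 | ≤ᵇ⇒≤ r (24 * k + 18)
... | false | _      = refl
... | true  | r≤half = contradiction (r≤half tt) (<⇒≱ half<r)

1+2m∸[1+2[m∸t]]≡2t : ∀ m {t} → t ≤ m → 1 + 2 * m ∸ (1 + 2 * (m ∸ t)) ≡ 2 * t
1+2m∸[1+2[m∸t]]≡2t m {t} t≤m = begin
  2 * m ∸ 2 * (m ∸ t)        ≡⟨ cong (2 * m ∸_) (*-distribˡ-∸ 2 m t) ⟩
  2 * m ∸ (2 * m ∸ 2 * t)    ≡⟨ m∸[m∸n]≡n (*-monoʳ-≤ 2 t≤m) ⟩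
  2 * t                      ∎
  where open ≡-Reasoning

ord∸1≡half+[1+half] : ∀ k → 48 * k + 37 ≡ 24 * k + 18 + suc (24 * k + 18)
ord∸1≡half+[1+half] = solve-∀

half≤ord∸1 : ∀ k → 24 * k + 18 ≤ 48 * k + 37
half≤ord∸1 k = subst (24 * k + 18 ≤_) (sym (ord∸1≡half+[1+half] k)) (m≤m+n _ _)

c₂-hits-odd : ∀ k {t} → t ≤ 24 * k + 18 → ∃ λ r → r < ord k × c₂ k r ≡ 1 + 2 * t
c₂-hits-odd k t≤half with r , r≤half , c₂r≡ ← c₂-half-onto-odd k t≤half =
  r , s≤s (≤-trans r≤half (half≤ord∸1 k)) , trans (c₂-first-half k r≤half) c₂r≡

c₂-hits-even : ∀ k {t} → t ≤ 24 * k + 18 → ∃ λ r → r < ord k × c₂ k r ≡ 2 * t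
c₂-hits-even k {t} t≤half
  with r′ , r′≤half , c₂r′≡ ← c₂-half-onto-odd k (m∸n≤m (24 * k + 18) t) =
  r , s≤s (m∸n≤m _ r′) , value
  where
  M r : ℕ
  M = 24 * k + 18
  r = 48 * k + 37 ∸ r′

  r′≤ord∸1 : r′ ≤ 48 * k + 37
  r′≤ord∸1 = ≤-trans r′≤half (half≤ord∸1 k)

  half<r : M < r
  half<r = begin-strict
    M                   <⟨ n<1+n M ⟩
    suc M               ≡⟨ m+n∸m≡n M (suc M) ⟨
    M + suc M ∸ M       ≡⟨ cong (_∸ M) (ord∸1≡half+[1+half] k) ⟨
    48 * k + 37 ∸ M     ≤⟨ ∸-monoʳ-≤ (48 * k + 37) r′≤half ⟩
    r                   ∎
    where open ≤-Reasoning

  value : c₂ k r ≡ 2 * t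
  value = begin
    c₂ k r
      ≡⟨ c₂-second-half k half<r ⟩
    48 * k + 37 ∸ c₂-half k (48 * k + 37 ∸ r)
      ≡⟨ cong (λ v → 48 * k + 37 ∸ c₂-half k v) (m∸[m∸n]≡n r′≤ord∸1) ⟩
    48 * k + 37 ∸ c₂-half k r′
      ≡⟨ cong (48 * k + 37 ∸_) c₂r′≡ ⟩
    48 * k + 37 ∸ (1 + 2 * (M ∸ t))
      ≡⟨ cong (_∸ (1 + 2 * (M ∸ t))) (1+2*half≡ord∸1 k) ⟨
    1 + 2 * M ∸ (1 + 2 * (M ∸ t))
      ≡⟨ 1+2m∸[1+2[m∸t]]≡2t M t≤half ⟩
    2 * t
      ∎
    where open ≡-Reasoning

data Parity : ℕ → Set where
  even : ∀ t → Parity (2 * t)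
  odd  : ∀ t → Parity (1 + 2 * t)

parity : ∀ x → Parity x
parity zero = even 0
parity (suc x) with parity x
... | even t = odd t
... | odd  t = subst Parity (*-suc 2 t) (even (suc t))

c₂-onto : ∀ k {x} → x < ord k → ∃ λ (r : Fin (ord k)) → c₂ k (toℕ r) ≡ x
c₂-onto k {x} x<n = toFin (c₂-hits (parity x) x<n)
  where
  c₂-hits : ∀ {x} → Parity x → x < ord k → ∃ λ r → r < ord k × c₂ k r ≡ x
  c₂-hits (even t) 2t<n  = c₂-hits-even k (2t<ord⇒t≤half k {t} 2t<n)
  c₂-hits (odd t) 1+2t<n = c₂-hits-odd k (2t<ord⇒t≤half k {t} (<-trans (n<1+n _) 1+2t<n))

  toFin : ∃ (λ r → r < ord k × c₂ k r ≡ x) →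
          ∃ λ (r : Fin (ord k)) → c₂ k (toℕ r) ≡ x
  toFin (r , r<n , c₂r≡x) = fromℕ< r<n , trans (cong (c₂ k) (toℕ-fromℕ< r<n)) c₂r≡x

lemma8 : (k : ℕ) → IsLatinSquare (ord k) (L₂ k)
lemma8 k = shiftSquare-isLatinSquare (ord k) (c₂ k ∘ toℕ) (c₂-onto k)
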